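{- Let $k\geq 2$ be an integer, let $r=\lfloor\log_2(k)\rfloor+1$, and for $1\le j\le 2^r-1$ let $\zeta_j=\exp\left(\frac{\pi\sqrt{ -1}\,j}{2^{r-1}}\right)$ and $$c_j(k)=\frac{1}{2^r}\sum_{m=0}^{2^r-1}(-1)^{\binom{m}{k}}\zeta_j^{ -m}.$$ For $1\le j\le 2^r-1$, let $b\in\{0,1,\dots,r-1\}$ be the integer such that $\zeta_j$ is a primitive $2^{b+1}$-th root of unity (equivalently, $1+\zeta_j$ is a root of $\Phi_{2^{b+1}}(x-1)$, where $\Phi_m$ denotes the $m$-th cyclotomic polynomial). Then $c_j(k)=0$ if and only if $2^b$ does not appear in the binary ($2$-adic) expansion of $k$.
   Context: The numbers $c_j(k)$ are the coefficients of $(1+\zeta_j)^n$ in the closed form $S(\sigma_{n,k})=c_0(k)2^n+\sum_{j=1}^{2^r-1}c_j(k)(1+\zeta_j)^n$ of the exponential sum $S(\sigma_{n,k})=\sum_{i=0}^n(-1)^{\binom{i}{k}}\binom{n}{i}$ of the elementary symmetric Boolean polynomial of degree $k$ in $n$ variables. -}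

module Defs where

open import Data.Nat using (ℕ; zero; suc; _+_; _*_; _∸_; _^_; _%_; _/_; _≡ᵇ_; _<ᵇ_; NonZero)
open import Data.Nat.Properties using (m^n≢0)
open import Data.Nat.Logarithm using (⌊log₂_⌋)
open import Data.Nat.Combinatorics using (_C_)
open import Data.Fin using (Fin; toℕ)
open import Data.Vec using (Vec; tabulate; replicate)
open import Data.Integer using (+_)
open import Data.Rational as ℚ using (ℚ; 0ℚ; 1ℚ)
open import Data.Bool using (if_then_else_)
open import Data.Product using (_×_)
open import Relation.Binary.PropositionalEquality using (_≡_; _≢_)

r : ℕ → ℕ
r k = suc ⌊log₂ k ⌋

-- N = 2^r  (so the ζ_j are N-th roots of unity)
N : ℕ → ℕ
N k = 2 ^ r k

N-nonZero : ∀ k → NonZero (N k)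
N-nonZero k = m^n≢0 2 (r k)

modN : (k e : ℕ) → ℕ
modN k e = _%_ e (N k) {{N-nonZero k}}

-- H = 2^(r-1) = [Q(ζ_N) : Q]
H : ℕ → ℕ
H k = 2 ^ ⌊log₂ k ⌋

-- Model of the cyclotomic field Q(ω) ⊂ ℂ, ω = exp(π i / 2^(r-1)),
-- as Q[x]/(x^H + 1): an element is its coordinate vector w.r.t. the
-- Q-basis 1, ω, …, ω^(H-1).
K : ℕ → Set
K k = Vec ℚ (H k)

zeroK : (k : ℕ) → K k
zeroK k = replicate (H k) 0ℚ

-- ω^e  (using ω^H = -1)
ωpow : (k e : ℕ) → K k
ωpow k e = tabulate λ i →
  let e′ = modN k e in
  if e′ <ᵇ H k
    then (if toℕ i ≡ᵇ e′ then 1ℚ else 0ℚ)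
    else (if toℕ i ≡ᵇ (e′ ∸ H k) then ℚ.- 1ℚ else 0ℚ)

oneK : (k : ℕ) → K k
oneK k = ωpow k 0

-- ζ_j = exp(π i j / 2^(r-1)) = ω^j ;  ζ_j^d = ω^(j d)
ζpow : (k j d : ℕ) → K k
ζpow k j d = ωpow k (j * d)

-- ζ_j^(-m) = ω^(N - (j m mod N))
ζpowNeg : (k j m : ℕ) → K k
ζpowNeg k j m = ωpow k (N k ∸ modN k (j * m))

sgn : (k m : ℕ) → ℚ
sgn k m = if ((m C k) % 2) ≡ᵇ 0 then 1ℚ else ℚ.- 1ℚ

Σ< : ℕ → (ℕ → ℚ) → ℚ
Σ< zero f = 0ℚ
Σ< (suc n) f = Σ< n f ℚ.+ f n

c : (k j : ℕ) → K k
c k j = tabulate λ i →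
  (ℚ._/_ (+ 1) (N k) {{N-nonZero k}}) ℚ.* Σ< (N k) (λ m → sgn k m ℚ.* Data.Vec.lookup (ζpowNeg k j m) i)

IsPrimitiveRoot : (k j n : ℕ) → Set
IsPrimitiveRoot k j n =
  (ζpow k j n ≡ oneK k) × (∀ d → 1 Data.Nat.≤ d → d Data.Nat.< n → ζpow k j d ≢ oneK k)

BitSet : (k b : ℕ) → Set
BitSet k b = (_/_ k (2 ^ b) {{m^n≢0 2 b}}) % 2 ≡ 1

-- Write k = kHi·2^b + kLo with kLo < 2^b and split the summation index as m = d·2^b + l, l < 2^b.
-- Lucas' theorem modulo 2 gives binom(m,k) ≡ binom(d,kHi)·binom(l,kLo), and ζ_j^(2^b) = -1, so the
-- blocks d = 2e and d = 2e+1 run over the same powers of ζ_j with opposite signs. The bit of k at 2^b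
-- is the parity of kHi. If kHi is even, binom(2e,kHi) ≡ binom(2e+1,kHi) and the two blocks cancel.
-- If kHi = 2K+1, binom(2e,kHi) is even while binom(2e+1,kHi) ≡ binom(e,K). Since H ∤ j·l for
-- 0 < l < 2^b, the ζ_j^(-l) with l < 2^b are ± distinct vectors of the basis 1, ω, …, ω^(H-1), so at
-- the coordinate of ζ_j^(-kLo) only l = kLo contributes, and there 2^r c_j(k) = ±Σ_e (1 - (-1)^binom(e,K)),
-- which is at least 2 because of the term e = K.
module Submission where

open import Defs
open import Data.Bool using (Bool; true; false; if_then_else_)
open import Data.Empty using (⊥-elim)
open import Data.Fin using (Fin; toℕ; fromℕ<)
open import Data.Fin.Properties using (toℕ-fromℕ<)
import Data.Integer as ℤ
open import Data.Nat
open import Data.Nat.Combinatorics using (_C_; nCk+nC[k+1]≡[n+1]C[k+1]; nCn≡1; nC1≡n)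
open import Data.Nat.Divisibility
open import Data.Nat.DivMod
open import Data.Nat.Logarithm using (⌊log₂_⌋; ⌊log₂⌋-mono-≤; ⌊log₂[2^n]⌋≡n)
open import Data.Nat.Properties
open import Data.Nat.Tactic.RingSolver using (solve-∀)
open import Data.Parity.Base as ℙ using (Parity; 0ℙ; 1ℙ)
import Data.Parity.Properties as ℙ
open import Data.Product using (Σ; _,_; proj₁; proj₂)
open import Data.Rational as ℚ using (ℚ; 0ℚ; 1ℚ)
import Data.Rational.Properties as ℚP
open import Data.Sum using (_⊎_; inj₁; inj₂)
open import Data.Vec using (Vec; lookup; tabulate; replicate)
open import Data.Vec.Properties using (lookup∘tabulate; tabulate∘lookup; tabulate-cong; lookup-replicate)
open import Function using (_∘_)
open import Function.Bundles using (_⇔_; mk⇔)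
open import Relation.Binary.PropositionalEquality
open import Relation.Nullary using (¬_; yes; no; ofʸ; ofⁿ; contradiction)

open import Algebra.Properties.CommutativeSemigroup ℙ.*-commutativeSemigroup using (x∙yz≈y∙xz)
open import Algebra.Properties.Group ℚP.+-0-group using (⁻¹-involutive)

double : ℕ → ℕ
double zero = zero
double (suc n) = suc (suc (double n))

double≡2* : ∀ n → double n ≡ 2 * n
double≡2* zero = refl
double≡2* (suc n) = trans (cong (2 +_) (double≡2* n)) (sym (*-suc 2 n))

parity-double : ∀ n → parity (double n) ≡ 0ℙ
parity-double zero = refl
parity-double (suc n) = parity-double n

parity-suc-double : ∀ n → parity (suc (double n)) ≡ 1ℙ
parity-suc-double zero = refl
parity-suc-double (suc n) = parity-suc-double n

bit : Parity → ℕ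
bit 0ℙ = 0
bit 1ℙ = 1

halve : ∀ n → n ≡ bit (parity n) + double ⌊ n /2⌋
halve 0 = refl
halve 1 = refl
halve (suc (suc n)) =
  trans (cong (2 +_) (halve n)) (sym (trans (+-suc b _) (cong suc (+-suc b _))))
  where b = bit (parity n)

even⇒≡double : ∀ {n} → parity n ≡ 0ℙ → n ≡ double ⌊ n /2⌋
even⇒≡double {n} eq = trans (halve n) (cong (λ p → bit p + double ⌊ n /2⌋) eq)

odd⇒≡suc-double : ∀ {n} → parity n ≡ 1ℙ → n ≡ suc (double ⌊ n /2⌋)
odd⇒≡suc-double {n} eq = trans (halve n) (cong (λ p → bit p + double ⌊ n /2⌋) eq)

n%2≡bit[parity] : ∀ n → n % 2 ≡ bit (parity n)
n%2≡bit[parity] 0 = refl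
n%2≡bit[parity] 1 = refl
n%2≡bit[parity] (suc (suc n)) =
  trans (%-congˡ (+-comm 2 n)) (trans ([m+n]%n≡m%n n 2) (n%2≡bit[parity] n))

-- Lucas' theorem modulo 2

parity-pascal : ∀ n k → parity (suc n C suc k) ≡ parity (n C k) ℙ.+ parity (n C suc k)
parity-pascal n k =
  trans (cong parity (sym (nCk+nC[k+1]≡[n+1]C[k+1] n k))) (ℙ.+-homo-+ (n C k) (n C suc k))

LucasDigit : ℕ → ℕ → Set
LucasDigit d K = ∀ p q →
  parity ((bit p + double d) C (bit q + double K)) ≡ parity (bit p C bit q) ℙ.* parity (d C K)

lucas-digit : ∀ d K → LucasDigit d K
lucas-digit zero    zero    0ℙ 0ℙ = refl
lucas-digit zero    zero    0ℙ 1ℙ = refl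
lucas-digit zero    zero    1ℙ 0ℙ = refl
lucas-digit zero    zero    1ℙ 1ℙ = refl
lucas-digit zero    (suc K) 0ℙ 0ℙ = refl
lucas-digit zero    (suc K) 0ℙ 1ℙ = refl
lucas-digit zero    (suc K) 1ℙ 0ℙ = refl
lucas-digit zero    (suc K) 1ℙ 1ℙ = refl
lucas-digit (suc d) zero    0ℙ 0ℙ = refl
lucas-digit (suc d) zero    0ℙ 1ℙ = trans (cong parity (nC1≡n (double (suc d)))) (parity-double (suc d))
lucas-digit (suc d) zero    1ℙ 0ℙ = refl
lucas-digit (suc d) zero    1ℙ 1ℙ =
  trans (cong parity (nC1≡n (suc (double (suc d))))) (parity-suc-double (suc d))
lucas-digit (suc d) (suc K) = digit
  where
  n = double d
  k = double K
  IH₀ = lucas-digit d K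
  IH₁ = lucas-digit d (suc K)
  even-even : parity (suc (suc n) C suc (suc k)) ≡ parity (suc d C suc K)
  even-even = begin
    parity (suc (suc n) C suc (suc k))                       ≡⟨ parity-pascal (suc n) (suc k) ⟩
    parity (suc n C suc k) ℙ.+ parity (suc n C suc (suc k))  ≡⟨ cong₂ ℙ._+_ (IH₀ 1ℙ 1ℙ) (IH₁ 1ℙ 0ℙ) ⟩
    parity (d C K) ℙ.+ parity (d C suc K)                    ≡⟨ parity-pascal d K ⟨
    parity (suc d C suc K)                                   ∎
    where open ≡-Reasoning
  even-odd : parity (suc (suc n) C suc (suc (suc k))) ≡ 0ℙ
  even-odd = begin
    parity (suc (suc n) C suc (suc (suc k)))                        ≡⟨ parity-pascal (suc n) (suc (suc k)) ⟩
    parity (suc n C suc (suc k)) ℙ.+ parity (suc n C suc (suc (suc k))) ≡⟨ cong₂ ℙ._+_ (IH₁ 1ℙ 0ℙ) (IH₁ 1ℙ 1ℙ) ⟩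
    parity (d C suc K) ℙ.+ parity (d C suc K)                       ≡⟨ ℙ.p+p≡0ℙ (parity (d C suc K)) ⟩
    0ℙ                                                              ∎
    where open ≡-Reasoning
  odd-even : parity (suc (suc (suc n)) C suc (suc k)) ≡ parity (suc d C suc K)
  odd-even = begin
    parity (suc (suc (suc n)) C suc (suc k))                         ≡⟨ parity-pascal (suc (suc n)) (suc k) ⟩
    parity (suc (suc n) C suc k) ℙ.+ parity (suc (suc n) C suc (suc k)) ≡⟨ cong₂ ℙ._+_ odd-below even-even ⟩
    0ℙ ℙ.+ parity (suc d C suc K)                                    ∎
    where
    open ≡-Reasoning
    odd-below : parity (suc (suc n) C suc k) ≡ 0ℙ
    odd-below = trans (parity-pascal (suc n) k)
                      (trans (cong₂ ℙ._+_ (IH₀ 1ℙ 0ℙ) (IH₀ 1ℙ 1ℙ)) (ℙ.p+p≡0ℙ (parity (d C K))))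
  odd-odd : parity (suc (suc (suc n)) C suc (suc (suc k))) ≡ parity (suc d C suc K)
  odd-odd = begin
    parity (suc (suc (suc n)) C suc (suc (suc k)))                            ≡⟨ parity-pascal (suc (suc n)) (suc (suc k)) ⟩
    parity (suc (suc n) C suc (suc k)) ℙ.+ parity (suc (suc n) C suc (suc (suc k))) ≡⟨ cong₂ ℙ._+_ even-even even-odd ⟩
    parity (suc d C suc K) ℙ.+ 0ℙ                                             ≡⟨ ℙ.+-identityʳ _ ⟩
    parity (suc d C suc K)                                                    ∎
    where open ≡-Reasoning
  digit : LucasDigit (suc d) (suc K)
  digit 0ℙ 0ℙ = even-even
  digit 0ℙ 1ℙ = even-odd
  digit 1ℙ 0ℙ = odd-even
  digit 1ℙ 1ℙ = odd-odd

digits-split : ∀ d m x y → d * (2 * m) + (x + double y) ≡ x + double (d * m + y)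
digits-split d m x y rewrite double≡2* y | double≡2* (d * m + y) = ring d m x y
  where
  ring : ∀ d m x y → d * (2 * m) + (x + 2 * y) ≡ x + 2 * (d * m + y)
  ring = solve-∀

halve-< : ∀ {p l m} → bit p + double l < 2 * m → l < m
halve-< {p} {l} h = *-cancelˡ-< 2 l _ (subst (_< _) (double≡2* l) (≤-<-trans (m≤n+m (double l) (bit p)) h))

lucas : ∀ b d K l Y → l < 2 ^ b → Y < 2 ^ b →
        parity ((d * 2 ^ b + l) C (K * 2 ^ b + Y)) ≡ parity (d C K) ℙ.* parity (l C Y)
lucas zero d K zero zero _ _ rewrite *-identityʳ d | *-identityʳ K | +-identityʳ d | +-identityʳ K =
  sym (ℙ.*-identityʳ (parity (d C K)))
lucas zero d K (suc l) Y (s≤s ()) _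
lucas zero d K zero (suc Y) _ (s≤s ())
lucas (suc b) d K l Y l< Y< =
  subst₂ (λ l Y → parity ((d * 2 ^ suc b + l) C (K * 2 ^ suc b + Y)) ≡ parity (d C K) ℙ.* parity (l C Y))
         (sym (halve l)) (sym (halve Y))
         (step (parity l) (parity Y) ⌊ l /2⌋ ⌊ Y /2⌋ (halve-< (subst (_< _) (halve l) l<)) (halve-< (subst (_< _) (halve Y) Y<)))
  where
  step : ∀ p q l Y → l < 2 ^ b → Y < 2 ^ b →
         parity ((d * 2 ^ suc b + (bit p + double l)) C (K * 2 ^ suc b + (bit q + double Y)))
           ≡ parity (d C K) ℙ.* parity ((bit p + double l) C (bit q + double Y))
  step p q l Y l< Y< = begin
    parity ((d * 2 ^ suc b + (bit p + double l)) C (K * 2 ^ suc b + (bit q + double Y)))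
      ≡⟨ cong₂ (λ n k → parity (n C k)) (digits-split d (2 ^ b) (bit p) l) (digits-split K (2 ^ b) (bit q) Y) ⟩
    parity ((bit p + double (d * 2 ^ b + l)) C (bit q + double (K * 2 ^ b + Y)))
      ≡⟨ lucas-digit (d * 2 ^ b + l) (K * 2 ^ b + Y) p q ⟩
    parity (bit p C bit q) ℙ.* parity ((d * 2 ^ b + l) C (K * 2 ^ b + Y))
      ≡⟨ cong (parity (bit p C bit q) ℙ.*_) (lucas b d K l Y l< Y<) ⟩
    parity (bit p C bit q) ℙ.* (parity (d C K) ℙ.* parity (l C Y))
      ≡⟨ x∙yz≈y∙xz (parity (bit p C bit q)) (parity (d C K)) (parity (l C Y)) ⟩
    parity (d C K) ℙ.* (parity (bit p C bit q) ℙ.* parity (l C Y))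
      ≡⟨ cong (parity (d C K) ℙ.*_) (lucas-digit l Y p q) ⟨
    parity (d C K) ℙ.* parity ((bit p + double l) C (bit q + double Y)) ∎
    where open ≡-Reasoning

Σ<-cong : ∀ n {f g : ℕ → ℚ} → (∀ m → m < n → f m ≡ g m) → Σ< n f ≡ Σ< n g
Σ<-cong zero    eq = refl
Σ<-cong (suc n) eq = cong₂ ℚ._+_ (Σ<-cong n (λ m m<n → eq m (m<n⇒m<1+n m<n))) (eq n (n<1+n n))

Σ<-zero : ∀ n {f : ℕ → ℚ} → (∀ m → m < n → f m ≡ 0ℚ) → Σ< n f ≡ 0ℚ
Σ<-zero zero    eq = refl
Σ<-zero (suc n) eq =
  trans (cong₂ ℚ._+_ (Σ<-zero n (λ m m<n → eq m (m<n⇒m<1+n m<n))) (eq n (n<1+n n))) (ℚP.+-identityʳ 0ℚ)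

Σ<-+ : ∀ a n f → Σ< (a + n) f ≡ Σ< a f ℚ.+ Σ< n (λ m → f (a + m))
Σ<-+ a zero    f rewrite +-identityʳ a = sym (ℚP.+-identityʳ (Σ< a f))
Σ<-+ a (suc n) f rewrite +-suc a n =
  trans (cong (ℚ._+ f (a + n)) (Σ<-+ a n f)) (ℚP.+-assoc (Σ< a f) _ (f (a + n)))

Σ<-blocks : ∀ D B f → Σ< (D * B) f ≡ Σ< D (λ d → Σ< B (λ l → f (d * B + l)))
Σ<-blocks zero    B f = refl
Σ<-blocks (suc D) B f rewrite +-comm B (D * B) =
  trans (Σ<-+ (D * B) B f) (cong (ℚ._+ Σ< B (λ l → f (D * B + l))) (Σ<-blocks D B f))

Σ<-pairs : ∀ D f → Σ< (double D) f ≡ Σ< D (λ e → f (double e) ℚ.+ f (suc (double e)))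
Σ<-pairs zero    f = refl
Σ<-pairs (suc D) f =
  trans (ℚP.+-assoc (Σ< (double D) f) _ _) (cong (ℚ._+ (f (double D) ℚ.+ f (suc (double D)))) (Σ<-pairs D f))

Σ<-neg : ∀ n f → Σ< n (λ m → ℚ.- f m) ≡ ℚ.- Σ< n f
Σ<-neg zero    f = refl
Σ<-neg (suc n) f = trans (cong (ℚ._+ ℚ.- f n) (Σ<-neg n f)) (sym (ℚP.neg-distrib-+ (Σ< n f) (f n)))

Σ<-*ˡ : ∀ n q f → Σ< n (λ m → q ℚ.* f m) ≡ q ℚ.* Σ< n f
Σ<-*ˡ zero    q f = sym (ℚP.*-zeroʳ q)
Σ<-*ˡ (suc n) q f = trans (cong (ℚ._+ q ℚ.* f n) (Σ<-*ˡ n q f)) (sym (ℚP.*-distribˡ-+ q (Σ< n f) (f n)))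

Σ<-single : ∀ n Y f → Y < n → (∀ m → m < n → m ≢ Y → f m ≡ 0ℚ) → Σ< n f ≡ f Y
Σ<-single (suc n) Y f Y<1+n off with Y ≟ n
... | yes refl = trans (cong (ℚ._+ f Y) (Σ<-zero n (λ m m<n → off m (m<n⇒m<1+n m<n) (<⇒≢ m<n))))
                       (ℚP.+-identityˡ (f Y))
... | no Y≢n   = trans (cong₂ ℚ._+_ (Σ<-single n Y f (≤∧≢⇒< (≤-pred Y<1+n) Y≢n) (λ m m<n → off m (m<n⇒m<1+n m<n)))
                                    (off n (n<1+n n) (≢-sym Y≢n)))
                       (ℚP.+-identityʳ (f Y))

Σ<-nonNeg : ∀ n f → (∀ m → m < n → 0ℚ ℚ.≤ f m) → 0ℚ ℚ.≤ Σ< n f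
Σ<-nonNeg zero    f nonNeg = ℚP.≤-refl
Σ<-nonNeg (suc n) f nonNeg =
  ℚP.+-mono-≤ (Σ<-nonNeg n f (λ m m<n → nonNeg m (m<n⇒m<1+n m<n))) (nonNeg n (n<1+n n))

Σ<-≥-term : ∀ n f i → (∀ m → m < n → 0ℚ ℚ.≤ f m) → i < n → f i ℚ.≤ Σ< n f
Σ<-≥-term (suc n) f i nonNeg i<1+n with i ≟ n
... | yes refl = subst (ℚ._≤ Σ< n f ℚ.+ f i) (ℚP.+-identityˡ (f i))
                   (ℚP.+-monoˡ-≤ (f i) (Σ<-nonNeg n f (λ m m<n → nonNeg m (m<n⇒m<1+n m<n))))
... | no i≢n   = subst (ℚ._≤ Σ< n f ℚ.+ f n) (ℚP.+-identityʳ (f i))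
                   (ℚP.+-mono-≤ (Σ<-≥-term n f i (λ m m<n → nonNeg m (m<n⇒m<1+n m<n)) (≤∧≢⇒< (≤-pred i<1+n) i≢n))
                                (nonNeg n (n<1+n n)))

∣-complement : ∀ m n .{{_ : NonZero n}} → n ∣ (n ∸ m % n) + m
∣-complement m n = divides (suc (m / n)) (begin
  (n ∸ m % n) + m                   ≡⟨ cong ((n ∸ m % n) +_) (m≡m%n+[m/n]*n m n) ⟩
  (n ∸ m % n) + (m % n + m / n * n) ≡⟨ +-assoc (n ∸ m % n) (m % n) _ ⟨
  (n ∸ m % n) + m % n + m / n * n   ≡⟨ cong (_+ m / n * n) (m∸n+n≡m (m%n≤n m n)) ⟩
  n + m / n * n                     ∎)
  where open ≡-Reasoning

complement-unique : ∀ {a b c n} .{{_ : NonZero n}} → n ∣ a + c → n ∣ b + c → a % n ≡ b % n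
complement-unique {a} {b} {c} {n} a+c b+c = begin
  a % n               ≡⟨ %-remove-+ʳ a b+c ⟨
  (a + (b + c)) % n   ≡⟨ %-congˡ (reorder a b c) ⟩
  ((a + c) + b) % n   ≡⟨ %-remove-+ˡ b a+c ⟩
  b % n               ∎
  where
  open ≡-Reasoning
  reorder : ∀ a b c → a + (b + c) ≡ (a + c) + b
  reorder = solve-∀

%-≡-∣+ : ∀ {a b c n} .{{_ : NonZero n}} → a % n ≡ b % n → n ∣ a + c → n ∣ b + c
%-≡-∣+ {a} {b} {c} {n} a≡b a+c = m%n≡0⇒n∣m (b + c) n (begin
  (b + c) % n             ≡⟨ %-distribˡ-+ b c n ⟩
  (b % n + c % n) % n     ≡⟨ cong (λ x → (x + c % n) % n) a≡b ⟨
  (a % n + c % n) % n     ≡⟨ %-distribˡ-+ a c n ⟨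
  (a + c) % n             ≡⟨ n∣m⇒m%n≡0 (a + c) n a+c ⟩
  0                       ∎)
  where open ≡-Reasoning

∣-difference : ∀ {d a x y} → d ∣ a + x → d ∣ a + y → y ≤ x → d ∣ x ∸ y
∣-difference {d} {a} {x} {y} a+x a+y y≤x =
  ∣m+n∣m⇒∣n (subst (d ∣_) (split a x y y≤x) a+x) a+y
  where
  split : ∀ a x y → y ≤ x → a + x ≡ (a + y) + (x ∸ y)
  split a x y y≤x = trans (cong (a +_) (sym (m+[n∸m]≡n y≤x))) (sym (+-assoc a y (x ∸ y)))

2∣odd*⇒2∣ : ∀ o x → 2 ∣ suc (double o) * x → 2 ∣ x
2∣odd*⇒2∣ o x 2∣ox = ∣m+n∣m⇒∣n (subst (2 ∣_) (+-comm x (double o * x)) 2∣ox)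
                              (∣m⇒∣m*n x (subst (2 ∣_) (sym (double≡2* o)) (m∣m*n o)))

2^p∣odd*⇒2^p∣ : ∀ p o x → 2 ^ p ∣ suc (double o) * x → 2 ^ p ∣ x
2^p∣odd*⇒2^p∣ zero    o x _ = 1∣ x
2^p∣odd*⇒2^p∣ (suc p) o x 2^[1+p]∣ with 2∣odd*⇒2∣ o x (∣-trans (m∣m*n (2 ^ p)) 2^[1+p]∣)
... | divides q refl = subst (2 ^ suc p ∣_) (*-comm 2 q) (*-monoʳ-∣ 2 (2^p∣odd*⇒2^p∣ p o q 2^p∣))
  where
  regroup : ∀ o q → o * (q * 2) ≡ 2 * (o * q)
  regroup = solve-∀
  2^p∣ : 2 ^ p ∣ suc (double o) * q
  2^p∣ = *-cancelˡ-∣ 2 (subst (2 ^ suc p ∣_) (regroup (suc (double o)) q) 2^[1+p]∣)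

k<N : ∀ k → k < N k
k<N k = ≰⇒> λ N≤k → 1+n≰n (subst (_≤ ⌊log₂ k ⌋) (⌊log₂[2^n]⌋≡n (r k)) (⌊log₂⌋-mono-≤ N≤k))

lookup⇒≡replicate : ∀ {n} {A : Set} (v : Vec A n) x → (∀ i → lookup v i ≡ x) → v ≡ replicate n x
lookup⇒≡replicate {n} v x eq = begin
  v                            ≡⟨ tabulate∘lookup v ⟨
  tabulate (lookup v)          ≡⟨ tabulate-cong (λ i → trans (eq i) (sym (lookup-replicate i x))) ⟩
  tabulate (lookup (replicate n x)) ≡⟨ tabulate∘lookup (replicate n x) ⟩
  replicate n x                ∎
  where open ≡-Reasoning

δ : Bool → ℚ
δ b = if b then 1ℚ else 0ℚ

δ-≡ : ∀ {m n} → m ≡ n → δ (m ≡ᵇ n) ≡ 1ℚ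
δ-≡ {m} {n} m≡n with m ≡ᵇ n | ≡⇒≡ᵇ m n m≡n
... | true | _ = refl

δ-≢ : ∀ {m n} → m ≢ n → δ (m ≡ᵇ n) ≡ 0ℚ
δ-≢ {m} {n} m≢n with m ≡ᵇ n | ≡ᵇ⇒≡ m n
... | false | _  = refl
... | true  | eq = contradiction (eq _) m≢n

neg-δ : ∀ b → (if b then ℚ.- 1ℚ else 0ℚ) ≡ ℚ.- δ b
neg-δ true  = refl
neg-δ false = refl

Unit : ℚ → Set
Unit v = v ≡ 1ℚ ⊎ v ≡ ℚ.- 1ℚ

-δ≢1 : ∀ b → ℚ.- δ b ≢ 1ℚ
-δ≢1 true  ()
-δ≢1 false ()

module Coordinates (k : ℕ) where

  instance
    N≢0 : NonZero (N k)
    N≢0 = N-nonZero k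
    H≢0 : NonZero (H k)
    H≢0 = m^n≢0 2 ⌊log₂ k ⌋

  N≡H+H : N k ≡ H k + H k
  N≡H+H = cong (H k +_) (+-identityʳ (H k))

  H∣N : H k ∣ N k
  H∣N = divides 2 refl

  %N%H≡%H : ∀ e → e % N k % H k ≡ e % H k
  %N%H≡%H e = m∣n⇒o%n%m≡o%m (H k) (N k) e H∣N

  -- the coordinate of ω^z in the basis 1, ω, …, ω^(H-1), for z < N
  reduced : Fin (H k) → ℕ → ℚ
  reduced i z = if z <ᵇ H k then δ (toℕ i ≡ᵇ z) else (if toℕ i ≡ᵇ (z ∸ H k) then ℚ.- 1ℚ else 0ℚ)

  lookup-ωpow : ∀ e i → lookup (ωpow k e) i ≡ reduced i (e % N k)
  lookup-ωpow e i = lookup∘tabulate (λ i → reduced i (e % N k)) i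

  ωpow-cong : ∀ {e e′} → e % N k ≡ e′ % N k → ωpow k e ≡ ωpow k e′
  ωpow-cong = cong λ z → tabulate λ i → reduced i z

  reduced-low : ∀ {z} i → z < H k → reduced i z ≡ δ (toℕ i ≡ᵇ z)
  reduced-low {z} i z<H with z <ᵇ H k | <ᵇ-reflects-< z (H k)
  ... | true  | _       = refl
  ... | false | ofⁿ z≮H = contradiction z<H z≮H

  reduced-high : ∀ {z} i → H k ≤ z → reduced i z ≡ ℚ.- δ (toℕ i ≡ᵇ (z ∸ H k))
  reduced-high {z} i H≤z with z <ᵇ H k | <ᵇ-reflects-< z (H k)
  ... | false | _       = neg-δ (toℕ i ≡ᵇ (z ∸ H k))
  ... | true  | ofʸ z<H = contradiction H≤z (<⇒≱ z<H)

  high-reduce : ∀ {z} → H k ≤ z → z < N k → z ∸ H k < H k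
  high-reduce {z} H≤z z<N = m<n+o⇒m∸n<o z (H k) (subst (z <_) N≡H+H z<N)

  reduced-+H : ∀ {z} i → z < N k → reduced i ((H k + z) % N k) ≡ ℚ.- reduced i z
  reduced-+H {z} i z<N with z <? H k
  ... | yes z<H = begin
    reduced i ((H k + z) % N k)        ≡⟨ cong (reduced i) (m<n⇒m%n≡m (subst (H k + z <_) (sym N≡H+H) (+-monoʳ-< (H k) z<H))) ⟩
    reduced i (H k + z)                ≡⟨ reduced-high i (m≤m+n (H k) z) ⟩
    ℚ.- δ (toℕ i ≡ᵇ (H k + z ∸ H k))   ≡⟨ cong (λ x → ℚ.- δ (toℕ i ≡ᵇ x)) (m+n∸m≡n (H k) z) ⟩
    ℚ.- δ (toℕ i ≡ᵇ z)                 ≡⟨ cong ℚ.-_ (reduced-low i z<H) ⟨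
    ℚ.- reduced i z                    ∎
    where open ≡-Reasoning
  ... | no z≮H = begin
    reduced i ((H k + z) % N k)             ≡⟨ cong (reduced i) (%-congˡ H+z≡z∸H+N) ⟩
    reduced i ((z ∸ H k + N k) % N k)       ≡⟨ cong (reduced i) ([m+n]%n≡m%n (z ∸ H k) (N k)) ⟩
    reduced i ((z ∸ H k) % N k)             ≡⟨ cong (reduced i) (m<n⇒m%n≡m (≤-<-trans (m∸n≤m z (H k)) z<N)) ⟩
    reduced i (z ∸ H k)                     ≡⟨ reduced-low i (high-reduce H≤z z<N) ⟩
    δ (toℕ i ≡ᵇ (z ∸ H k))                  ≡⟨ ⁻¹-involutive _ ⟨
    ℚ.- ℚ.- δ (toℕ i ≡ᵇ (z ∸ H k))          ≡⟨ cong ℚ.-_ (reduced-high i H≤z) ⟨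
    ℚ.- reduced i z                         ∎
    where
    open ≡-Reasoning
    H≤z = ≮⇒≥ z≮H
    H+z≡z∸H+N : H k + z ≡ z ∸ H k + N k
    H+z≡z∸H+N = begin
      H k + z                 ≡⟨ cong (H k +_) (m∸n+n≡m H≤z) ⟨
      H k + (z ∸ H k + H k)   ≡⟨ rotate (H k) (z ∸ H k) ⟩
      z ∸ H k + (H k + H k)   ≡⟨ cong (z ∸ H k +_) N≡H+H ⟨
      z ∸ H k + N k           ∎
      where
      rotate : ∀ h x → h + (x + h) ≡ x + (h + h)
      rotate = solve-∀

  ωpow-+H : ∀ e i → lookup (ωpow k (H k + e)) i ≡ ℚ.- lookup (ωpow k e) i
  ωpow-+H e i = begin
    lookup (ωpow k (H k + e)) i        ≡⟨ lookup-ωpow (H k + e) i ⟩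
    reduced i ((H k + e) % N k)        ≡⟨ cong (reduced i) (%-distribˡ-+ (H k) e (N k)) ⟩
    reduced i ((H k % N k + e % N k) % N k)         ≡⟨ cong (λ x → reduced i ((H k % N k + x) % N k)) (m%n%n≡m%n e (N k)) ⟨
    reduced i ((H k % N k + e % N k % N k) % N k)   ≡⟨ cong (reduced i) (%-distribˡ-+ (H k) (e % N k) (N k)) ⟨
    reduced i ((H k + e % N k) % N k)  ≡⟨ reduced-+H i (m%n<n e (N k)) ⟩
    ℚ.- reduced i (e % N k)            ≡⟨ cong ℚ.-_ (lookup-ωpow e i) ⟨
    ℚ.- lookup (ωpow k e) i            ∎
    where open ≡-Reasoning

  ωpow-± : ∀ e i → lookup (ωpow k e) i ≡ δ (toℕ i ≡ᵇ e % H k) ⊎ lookup (ωpow k e) i ≡ ℚ.- δ (toℕ i ≡ᵇ e % H k)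
  ωpow-± e i with e % N k <? H k
  ... | yes z<H = inj₁ (begin
    lookup (ωpow k e) i           ≡⟨ lookup-ωpow e i ⟩
    reduced i (e % N k)           ≡⟨ reduced-low i z<H ⟩
    δ (toℕ i ≡ᵇ e % N k)          ≡⟨ cong (λ x → δ (toℕ i ≡ᵇ x)) (trans (sym (m<n⇒m%n≡m z<H)) (%N%H≡%H e)) ⟩
    δ (toℕ i ≡ᵇ e % H k)          ∎)
    where open ≡-Reasoning
  ... | no z≮H = inj₂ (begin
    lookup (ωpow k e) i           ≡⟨ lookup-ωpow e i ⟩
    reduced i (e % N k)           ≡⟨ reduced-high i H≤z ⟩
    ℚ.- δ (toℕ i ≡ᵇ (e % N k ∸ H k))  ≡⟨ cong (λ x → ℚ.- δ (toℕ i ≡ᵇ x)) (trans z∸H≡z%H (%N%H≡%H e)) ⟩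
    ℚ.- δ (toℕ i ≡ᵇ e % H k)      ∎)
    where
    open ≡-Reasoning
    H≤z = ≮⇒≥ z≮H
    z∸H≡z%H : e % N k ∸ H k ≡ e % N k % H k
    z∸H≡z%H = begin
      e % N k ∸ H k                    ≡⟨ m<n⇒m%n≡m (high-reduce H≤z (m%n<n e (N k))) ⟨
      (e % N k ∸ H k) % H k            ≡⟨ [m+n]%n≡m%n (e % N k ∸ H k) (H k) ⟨
      (e % N k ∸ H k + H k) % H k      ≡⟨ %-congˡ (m∸n+n≡m H≤z) ⟩
      e % N k % H k                    ∎

  ωpow-off : ∀ e i → toℕ i ≢ e % H k → lookup (ωpow k e) i ≡ 0ℚ
  ωpow-off e i i≢ with ωpow-± e i
  ... | inj₁ eq = trans eq (δ-≢ i≢)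
  ... | inj₂ eq = trans eq (cong ℚ.-_ (δ-≢ i≢))

  ωpow-on : ∀ e → Unit (lookup (ωpow k e) (fromℕ< (m%n<n e (H k))))
  ωpow-on e with ωpow-± e (fromℕ< (m%n<n e (H k)))
  ... | inj₁ eq = inj₁ (trans eq (δ-≡ (toℕ-fromℕ< (m%n<n e (H k)))))
  ... | inj₂ eq = inj₂ (trans eq (cong ℚ.-_ (δ-≡ (toℕ-fromℕ< (m%n<n e (H k))))))

  ωpow≡1⇒N∣ : ∀ e → ωpow k e ≡ oneK k → N k ∣ e
  ωpow≡1⇒N∣ e ω^e≡1 = m%n≡0⇒n∣m e (N k) (reduced₀≡1⇒≡0 (begin
    reduced i₀ (e % N k)      ≡⟨ lookup-ωpow e i₀ ⟨
    lookup (ωpow k e) i₀      ≡⟨ cong (λ v → lookup v i₀) ω^e≡1 ⟩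
    lookup (ωpow k 0) i₀      ≡⟨ lookup-ωpow 0 i₀ ⟩
    reduced i₀ (0 % N k)      ≡⟨ cong (reduced i₀) (m<n⇒m%n≡m (>-nonZero⁻¹ (N k))) ⟩
    reduced i₀ 0              ≡⟨ reduced-low i₀ (>-nonZero⁻¹ (H k)) ⟩
    δ (toℕ i₀ ≡ᵇ 0)           ≡⟨ δ-≡ toℕi₀≡0 ⟩
    1ℚ                        ∎))
    where
    open ≡-Reasoning
    i₀ : Fin (H k)
    i₀ = fromℕ< (>-nonZero⁻¹ (H k))
    toℕi₀≡0 : toℕ i₀ ≡ 0
    toℕi₀≡0 = toℕ-fromℕ< (>-nonZero⁻¹ (H k))
    reduced₀≡1⇒≡0 : ∀ {z} → reduced i₀ z ≡ 1ℚ → z ≡ 0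
    reduced₀≡1⇒≡0 {zero}  _  = refl
    reduced₀≡1⇒≡0 {suc z} eq with suc z <? H k
    ... | yes z<H = contradiction (trans (sym eq) (trans (reduced-low i₀ z<H) (δ-≢ i₀≢1+z))) λ ()
      where
      i₀≢1+z : toℕ i₀ ≢ suc z
      i₀≢1+z i₀≡ = 0≢1+n (trans (sym toℕi₀≡0) i₀≡)
    ... | no z≮H  = ⊥-elim (-δ≢1 _ (trans (sym (reduced-high i₀ (≮⇒≥ z≮H))) eq))

-- Splitting the defining sum of c_j(k) into blocks of length 2^b

sign : Parity → ℚ
sign 0ℙ = 1ℚ
sign 1ℙ = ℚ.- 1ℚ

sgn≡sign : ∀ k m → sgn k m ≡ sign (parity (m C k))
sgn≡sign k m = trans (cong (λ x → if x ≡ᵇ 0 then 1ℚ else ℚ.- 1ℚ) (n%2≡bit[parity] (m C k))) (by-parity (parity (m C k)))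
  where
  by-parity : ∀ p → (if bit p ≡ᵇ 0 then 1ℚ else ℚ.- 1ℚ) ≡ sign p
  by-parity 0ℙ = refl
  by-parity 1ℙ = refl

gap : Parity → ℚ
gap p = 1ℚ ℚ.- sign p

gap-nonNeg : ∀ p → 0ℚ ℚ.≤ gap p
gap-nonNeg 0ℙ = ℚP.≤-refl
gap-nonNeg 1ℙ = ℚP.nonNegative⁻¹ (gap 1ℙ)

unit-pair : ∀ p {v} → Unit v → sign 0ℙ ℚ.* v ℚ.+ sign p ℚ.* ℚ.- v ≡ v ℚ.* gap p
unit-pair 0ℙ (inj₁ refl) = refl
unit-pair 0ℙ (inj₂ refl) = refl
unit-pair 1ℙ (inj₁ refl) = refl
unit-pair 1ℙ (inj₂ refl) = refl

pos*unit*pos≢0 : ∀ {q v t} → ℚ.Positive q → Unit v → ℚ.Positive t → q ℚ.* (v ℚ.* t) ≢ 0ℚ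
pos*unit*pos≢0 {q} {t = t} q>0 (inj₁ refl) t>0 eq =
  pos≢0 (subst ℚ.Positive eq (ℚP.pos*pos⇒pos q {{q>0}} (1ℚ ℚ.* t) {{ℚP.pos*pos⇒pos 1ℚ t {{t>0}}}}))
  where
  pos≢0 : ¬ ℚ.Positive 0ℚ
  pos≢0 ()
pos*unit*pos≢0 {q} {t = t} q>0 (inj₂ refl) t>0 eq =
  neg≢0 (subst ℚ.Negative eq (ℚP.pos*neg⇒neg q {{q>0}} (ℚ.- 1ℚ ℚ.* t) {{ℚP.neg*pos⇒neg (ℚ.- 1ℚ) t {{t>0}}}}))
  where
  neg≢0 : ¬ ℚ.Negative 0ℚ
  neg≢0 ()

module Block (k j b : ℕ) (b<r : b < r k) (prim : IsPrimitiveRoot k j (2 ^ suc b)) where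
  open Coordinates k

  B : ℕ
  B = 2 ^ b

  instance
    B≢0 : NonZero B
    B≢0 = m^n≢0 2 b

  D : ℕ
  D = 2 ^ (⌊log₂ k ⌋ ∸ b)

  N≡2DB : N k ≡ double D * B
  N≡2DB = begin
    2 * 2 ^ ⌊log₂ k ⌋                   ≡⟨ cong (λ x → 2 * 2 ^ x) (m∸n+n≡m (≤-pred b<r)) ⟨
    2 * 2 ^ (⌊log₂ k ⌋ ∸ b + b)         ≡⟨ cong (2 *_) (^-distribˡ-+-* 2 (⌊log₂ k ⌋ ∸ b) b) ⟩
    2 * (D * B)                         ≡⟨ *-assoc 2 D B ⟨
    2 * D * B                           ≡⟨ cong (_* B) (double≡2* D) ⟨
    double D * B                        ∎
    where open ≡-Reasoning

  N∣2jB : N k ∣ 2 * (j * B)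
  N∣2jB = subst (N k ∣_) (regroup j B) (ωpow≡1⇒N∣ (j * (2 * B)) (proj₁ prim))
    where
    regroup : ∀ j B → j * (2 * B) ≡ 2 * (j * B)
    regroup = solve-∀

  N∤jB : ¬ N k ∣ j * B
  N∤jB N∣jB = proj₂ prim B (>-nonZero⁻¹ B) B<2B
    (ωpow-cong (trans (n∣m⇒m%n≡0 (j * B) (N k) N∣jB) (sym (m<n⇒m%n≡m (>-nonZero⁻¹ (N k))))))
    where
    B<2B : B < 2 * B
    B<2B = m<m+n B (<-≤-trans (>-nonZero⁻¹ B) (m≤m+n B 0))

  -- ζ_j^B = -1, in the form j·B ≡ H·odd
  jB≡odd*H : Σ ℕ λ q → j * B ≡ suc (double q) * H k
  jB≡odd*H with *-cancelˡ-∣ 2 N∣2jB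
  ... | divides q jB≡qH = by-parity (parity q) ⌊ q /2⌋ (trans jB≡qH (cong (_* H k) (halve q)))
    where
    regroup : ∀ q h → 2 * q * h ≡ q * (2 * h)
    regroup = solve-∀
    by-parity : ∀ p q′ → j * B ≡ (bit p + double q′) * H k → Σ ℕ λ q → j * B ≡ suc (double q) * H k
    by-parity 1ℙ q′ eq = q′ , eq
    by-parity 0ℙ q′ eq =
      contradiction (divides q′ (trans eq (trans (cong (_* H k) (double≡2* q′)) (regroup q′ (H k))))) N∤jB

  jB/H : ℕ
  jB/H = suc (double (proj₁ jB≡odd*H))

  N∣H+jB : N k ∣ H k + j * B
  N∣H+jB = divides (suc (proj₁ jB≡odd*H)) (begin
    H k + j * B                         ≡⟨ cong (H k +_) (proj₂ jB≡odd*H) ⟩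
    H k + (1 + double q) * H k          ≡⟨ cong (λ x → H k + (1 + x) * H k) (double≡2* q) ⟩
    H k + (1 + 2 * q) * H k             ≡⟨ regroup q (H k) ⟩
    suc q * (2 * H k)                   ∎)
    where
    open ≡-Reasoning
    q = proj₁ jB≡odd*H
    regroup : ∀ q h → h + (1 + 2 * q) * h ≡ (1 + q) * (2 * h)
    regroup = solve-∀

  H∤jx : ∀ x → 0 < x → x < B → ¬ H k ∣ j * x
  H∤jx x 0<x x<B H∣jx = <⇒≱ x<B (∣⇒≤ {{>-nonZero 0<x}} B∣x)
    where
    jxB≡H*jB/H*x : j * x * B ≡ H k * (jB/H * x)
    jxB≡H*jB/H*x = begin
      j * x * B        ≡⟨ swap j x B ⟩
      j * B * x        ≡⟨ cong (_* x) (proj₂ jB≡odd*H) ⟩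
      jB/H * H k * x    ≡⟨ swap jB/H (H k) x ⟩
      jB/H * x * H k    ≡⟨ *-comm (jB/H * x) (H k) ⟩
      H k * (jB/H * x)  ∎
      where
      open ≡-Reasoning
      swap : ∀ a b c → a * b * c ≡ a * c * b
      swap = solve-∀
    B∣x : B ∣ x
    B∣x = 2^p∣odd*⇒2^p∣ b (proj₁ jB≡odd*H) x
            (*-cancelˡ-∣ (H k) (subst (H k * B ∣_) jxB≡H*jB/H*x (*-monoˡ-∣ B H∣jx)))

  residues-apart : ∀ {a x y} → x < B → y ≤ x → H k ∣ a + j * x → H k ∣ a + j * y → x ≡ y
  residues-apart {a} {x} {y} x<B y≤x H∣x H∣y with x ≟ y
  ... | yes x≡y = x≡y
  ... | no x≢y  = contradiction H∣j[x∸y] (H∤jx (x ∸ y) (m<n⇒0<n∸m y<x) (≤-<-trans (m∸n≤m x y) x<B))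
    where
    y<x : y < x
    y<x = ≤∧≢⇒< y≤x (≢-sym x≢y)
    H∣j[x∸y] : H k ∣ j * (x ∸ y)
    H∣j[x∸y] = subst (H k ∣_) (sym (*-distribˡ-∸ j x y)) (∣-difference H∣x H∣y (*-monoʳ-≤ j y≤x))

  residues-distinct : ∀ {a l l′} → H k ∣ a + j * l → H k ∣ a + j * l′ → l < B → l′ < B → l ≡ l′
  residues-distinct {l = l} {l′} H∣l H∣l′ l<B l′<B with ≤-total l l′
  ... | inj₁ l≤l′ = sym (residues-apart l′<B l≤l′ H∣l′ H∣l)
  ... | inj₂ l′≤l = residues-apart l<B l′≤l H∣l H∣l′

  -- ζ_j^(-m) = ω^(ζexp m) by the definition of ζpowNeg
  ζexp : ℕ → ℕ
  ζexp m = N k ∸ (j * m) % N k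

  N∣ζexp+jm : ∀ m → N k ∣ ζexp m + j * m
  N∣ζexp+jm m = ∣-complement (j * m) (N k)

  ζpowNeg≡ωpow : ∀ {z} m → N k ∣ z + j * m → ζpowNeg k j m ≡ ωpow k z
  ζpowNeg≡ωpow m N∣z+jm = ωpow-cong (complement-unique (N∣ζexp+jm m) N∣z+jm)

  V : Fin (H k) → ℕ → ℚ
  V i m = lookup (ζpowNeg k j m) i

  V-+B : ∀ i m → V i (B + m) ≡ ℚ.- V i m
  V-+B i m = trans (cong (λ v → lookup v i) (ζpowNeg≡ωpow (B + m) N∣)) (ωpow-+H (ζexp m) i)
    where
    regroup : ∀ h x j b m → (h + j * b) + (x + j * m) ≡ (h + x) + j * (b + m)
    regroup = solve-∀
    N∣ : N k ∣ (H k + ζexp m) + j * (B + m)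
    N∣ = subst (N k ∣_) (regroup (H k) (ζexp m) j B m) (∣m∣n⇒∣m+n N∣H+jB (N∣ζexp+jm m))

  V-suc : ∀ i d l → V i (suc d * B + l) ≡ ℚ.- V i (d * B + l)
  V-suc i d l = trans (cong (V i) (+-assoc B (d * B) l)) (V-+B i (d * B + l))

  V-double : ∀ i e l → V i (double e * B + l) ≡ V i l
  V-double i zero    l = refl
  V-double i (suc e) l = begin
    V i (suc (suc (double e)) * B + l)   ≡⟨ V-suc i (suc (double e)) l ⟩
    ℚ.- V i (suc (double e) * B + l)     ≡⟨ cong ℚ.-_ (V-suc i (double e) l) ⟩
    ℚ.- ℚ.- V i (double e * B + l)       ≡⟨ ⁻¹-involutive (V i (double e * B + l)) ⟩
    V i (double e * B + l)               ≡⟨ V-double i e l ⟩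
    V i l                                ∎
    where open ≡-Reasoning

  V-suc-double : ∀ i e l → V i (suc (double e) * B + l) ≡ ℚ.- V i l
  V-suc-double i e l = trans (V-suc i (double e) l) (cong ℚ.-_ (V-double i e l))

  V-vanish : ∀ i d l → V i l ≡ 0ℚ → V i (d * B + l) ≡ 0ℚ
  V-vanish i zero    l V≡0 = V≡0
  V-vanish i (suc d) l V≡0 = trans (V-suc i d l) (cong ℚ.-_ (V-vanish i d l V≡0))

  kHi kLo : ℕ
  kHi = k / B
  kLo = k % B

  kLo<B : kLo < B
  kLo<B = m%n<n k B

  k≡kHi*B+kLo : k ≡ kHi * B + kLo
  k≡kHi*B+kLo = trans (m≡m%n+[m/n]*n k B) (+-comm kLo (kHi * B))

  kHi<2D : kHi < double D
  kHi<2D = m<n*o⇒m/o<n (subst (k <_) N≡2DB (k<N k))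

  sgn-digits : ∀ d l → l < B → sgn k (d * B + l) ≡ sign (parity (d C kHi) ℙ.* parity (l C kLo))
  sgn-digits d l l<B = trans (sgn≡sign k (d * B + l)) (cong sign (begin
    parity ((d * B + l) C k)                   ≡⟨ cong (λ n → parity ((d * B + l) C n)) k≡kHi*B+kLo ⟩
    parity ((d * B + l) C (kHi * B + kLo))     ≡⟨ lucas b d kHi l kLo l<B kLo<B ⟩
    parity (d C kHi) ℙ.* parity (l C kLo)      ∎))
    where open ≡-Reasoning

  1/N : ℚ
  1/N = ℚ._/_ (ℤ.+ 1) (N k)

  term : Fin (H k) → ℕ → ℚ
  term i m = sgn k m ℚ.* V i m

  lookup-c : ∀ i → lookup (c k j) i ≡ 1/N ℚ.* Σ< (N k) (term i)
  lookup-c = lookup∘tabulate _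

  block : Fin (H k) → ℕ → ℚ
  block i d = Σ< B (λ l → term i (d * B + l))

  Σterm≡Σpairs : ∀ i → Σ< (N k) (term i) ≡ Σ< D (λ e → block i (double e) ℚ.+ block i (suc (double e)))
  Σterm≡Σpairs i = begin
    Σ< (N k) (term i)                  ≡⟨ cong (λ n → Σ< n (term i)) N≡2DB ⟩
    Σ< (double D * B) (term i)         ≡⟨ Σ<-blocks (double D) B (term i) ⟩
    Σ< (double D) (block i)            ≡⟨ Σ<-pairs D (block i) ⟩
    Σ< D (λ e → block i (double e) ℚ.+ block i (suc (double e))) ∎
    where open ≡-Reasoning

  block-odd≡-block-even : ∀ {K′} → kHi ≡ double K′ → ∀ i e → block i (suc (double e)) ≡ ℚ.- block i (double e)
  block-odd≡-block-even {K′} kHi≡2K′ i e = trans (Σ<-cong B odd≡-even) (Σ<-neg B (λ l → term i (double e * B + l)))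
    where
    same-parity : parity (suc (double e) C kHi) ≡ parity (double e C kHi)
    same-parity rewrite kHi≡2K′ = trans (lucas-digit e K′ 1ℙ 0ℙ) (sym (lucas-digit e K′ 0ℙ 0ℙ))
    odd≡-even : ∀ l → l < B → term i (suc (double e) * B + l) ≡ ℚ.- term i (double e * B + l)
    odd≡-even l l<B = begin
      sgn k (suc (double e) * B + l) ℚ.* V i (suc (double e) * B + l)
        ≡⟨ cong₂ ℚ._*_ (sgn-digits (suc (double e)) l l<B) (V-suc i (double e) l) ⟩
      sign (parity (suc (double e) C kHi) ℙ.* parity (l C kLo)) ℚ.* ℚ.- V i (double e * B + l)
        ≡⟨ cong (λ p → sign (p ℙ.* parity (l C kLo)) ℚ.* ℚ.- V i (double e * B + l)) same-parity ⟩
      sign (parity (double e C kHi) ℙ.* parity (l C kLo)) ℚ.* ℚ.- V i (double e * B + l)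
        ≡⟨ ℚP.neg-distribʳ-* (sign (parity (double e C kHi) ℙ.* parity (l C kLo))) (V i (double e * B + l)) ⟨
      ℚ.- (sign (parity (double e C kHi) ℙ.* parity (l C kLo)) ℚ.* V i (double e * B + l))
        ≡⟨ cong (λ s → ℚ.- (s ℚ.* V i (double e * B + l))) (sgn-digits (double e) l l<B) ⟨
      ℚ.- term i (double e * B + l) ∎
      where open ≡-Reasoning

  even⇒c≡0 : parity kHi ≡ 0ℙ → c k j ≡ zeroK k
  even⇒c≡0 even = lookup⇒≡replicate (c k j) 0ℚ λ i → begin
    lookup (c k j) i                                  ≡⟨ lookup-c i ⟩
    1/N ℚ.* Σ< (N k) (term i)       ≡⟨ cong (1/N ℚ.*_) (trans (Σterm≡Σpairs i) (Σ<-zero D (pair-cancels i))) ⟩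
    1/N ℚ.* 0ℚ                      ≡⟨ ℚP.*-zeroʳ 1/N ⟩
    0ℚ                                                ∎
    where
    open ≡-Reasoning
    pair-cancels : ∀ i e → e < D → block i (double e) ℚ.+ block i (suc (double e)) ≡ 0ℚ
    pair-cancels i e _ = trans (cong (block i (double e) ℚ.+_) (block-odd≡-block-even (even⇒≡double even) i e))
                               (ℚP.+-inverseʳ (block i (double e)))

  -- the coordinate of ζ_j^(-kLo); no other ζ_j^(-l) with l < B has a nonzero entry there
  i₀ : Fin (H k)
  i₀ = fromℕ< (m%n<n (ζexp kLo) (H k))

  same-residue⇒≡kLo : ∀ l → l < B → ζexp l % H k ≡ ζexp kLo % H k → l ≡ kLo
  same-residue⇒≡kLo l l<B same = residues-distinct (%-≡-∣+ same (H∣ l)) (H∣ kLo) l<B kLo<B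
    where
    H∣ : ∀ m → H k ∣ ζexp m + j * m
    H∣ m = ∣-trans H∣N (N∣ζexp+jm m)

  V-off : ∀ l → l < B → l ≢ kLo → V i₀ l ≡ 0ℚ
  V-off l l<B l≢kLo = ωpow-off (ζexp l) i₀ λ i₀≡ →
    l≢kLo (same-residue⇒≡kLo l l<B (trans (sym i₀≡) (toℕ-fromℕ< (m%n<n (ζexp kLo) (H k)))))

  block-single : ∀ d → block i₀ d ≡ term i₀ (d * B + kLo)
  block-single d = Σ<-single B kLo (λ l → term i₀ (d * B + l)) kLo<B λ l l<B l≢kLo →
    trans (cong (sgn k (d * B + l) ℚ.*_) (V-vanish i₀ d l (V-off l l<B l≢kLo))) (ℚP.*-zeroʳ (sgn k (d * B + l)))

  v : ℚ
  v = V i₀ kLo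

  pair-sum : ∀ {K′} → kHi ≡ suc (double K′) → ∀ e →
             block i₀ (double e) ℚ.+ block i₀ (suc (double e)) ≡ v ℚ.* gap (parity (e C K′))
  pair-sum {K′} kHi≡ e = begin
    block i₀ (double e) ℚ.+ block i₀ (suc (double e))
      ≡⟨ cong₂ ℚ._+_ (block-single (double e)) (block-single (suc (double e))) ⟩
    term i₀ (double e * B + kLo) ℚ.+ term i₀ (suc (double e) * B + kLo)
      ≡⟨ cong₂ ℚ._+_ (cong₂ ℚ._*_ (sgn-digits (double e) kLo kLo<B) (V-double i₀ e kLo))
                     (cong₂ ℚ._*_ (sgn-digits (suc (double e)) kLo kLo<B) (V-suc-double i₀ e kLo)) ⟩
    sign (parity (double e C kHi) ℙ.* parity (kLo C kLo)) ℚ.* v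
      ℚ.+ sign (parity (suc (double e) C kHi) ℙ.* parity (kLo C kLo)) ℚ.* ℚ.- v
      ≡⟨ cong₂ (λ p p′ → sign p ℚ.* v ℚ.+ sign p′ ℚ.* ℚ.- v) even-vanishes odd-survives ⟩
    sign 0ℙ ℚ.* v ℚ.+ sign (parity (e C K′)) ℚ.* ℚ.- v
      ≡⟨ unit-pair (parity (e C K′)) (ωpow-on (ζexp kLo)) ⟩
    v ℚ.* gap (parity (e C K′)) ∎
    where
    open ≡-Reasoning
    kLo-self : parity (kLo C kLo) ≡ 1ℙ
    kLo-self = cong parity (nCn≡1 kLo)
    even-vanishes : parity (double e C kHi) ℙ.* parity (kLo C kLo) ≡ 0ℙ
    even-vanishes rewrite kHi≡ = cong (ℙ._* parity (kLo C kLo)) (lucas-digit e K′ 0ℙ 1ℙ)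
    odd-survives : parity (suc (double e) C kHi) ℙ.* parity (kLo C kLo) ≡ parity (e C K′)
    odd-survives rewrite kHi≡ | kLo-self = trans (ℙ.*-identityʳ _) (lucas-digit e K′ 1ℙ 1ℙ)

  Σgap-pos : ∀ K′ → K′ < D → ℚ.Positive (Σ< D (λ e → gap (parity (e C K′))))
  Σgap-pos K′ K′<D = ℚ.positive (ℚP.<-≤-trans (ℚP.positive⁻¹ (gap 1ℙ))
    (subst (ℚ._≤ Σ< D (λ e → gap (parity (e C K′)))) (cong (gap ∘ parity) (nCn≡1 K′))
           (Σ<-≥-term D (λ e → gap (parity (e C K′))) K′ (λ e _ → gap-nonNeg (parity (e C K′))) K′<D)))

  Σterm-i₀ : ∀ {K′} → kHi ≡ suc (double K′) → Σ< (N k) (term i₀) ≡ v ℚ.* Σ< D (λ e → gap (parity (e C K′)))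
  Σterm-i₀ {K′} kHi≡ = begin
    Σ< (N k) (term i₀)                                        ≡⟨ Σterm≡Σpairs i₀ ⟩
    Σ< D (λ e → block i₀ (double e) ℚ.+ block i₀ (suc (double e))) ≡⟨ Σ<-cong D (λ e _ → pair-sum kHi≡ e) ⟩
    Σ< D (λ e → v ℚ.* gap (parity (e C K′)))                  ≡⟨ Σ<-*ˡ D v (λ e → gap (parity (e C K′))) ⟩
    v ℚ.* Σ< D (λ e → gap (parity (e C K′)))                  ∎
    where open ≡-Reasoning

  odd⇒c≢0 : parity kHi ≡ 1ℙ → c k j ≢ zeroK k
  odd⇒c≢0 odd c≡0 = pos*unit*pos≢0 {1/N} {v} (ℚP.normalize-pos 1 (N k)) (ωpow-on (ζexp kLo)) (Σgap-pos K′ K′<D) (begin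
    1/N ℚ.* (v ℚ.* Σ< D (λ e → gap (parity (e C K′))))   ≡⟨ cong (1/N ℚ.*_) (Σterm-i₀ kHi≡) ⟨
    1/N ℚ.* Σ< (N k) (term i₀)                          ≡⟨ lookup-c i₀ ⟨
    lookup (c k j) i₀                                   ≡⟨ cong (λ w → lookup w i₀) c≡0 ⟩
    lookup (zeroK k) i₀                                 ≡⟨ lookup-replicate i₀ 0ℚ ⟩
    0ℚ                                                  ∎)
    where
    open ≡-Reasoning
    K′ = ⌊ kHi /2⌋
    kHi≡ : kHi ≡ suc (double K′)
    kHi≡ = odd⇒≡suc-double odd
    K′<D : K′ < D
    K′<D = halve-< {1ℙ} (subst (_< 2 * D) kHi≡ (subst (kHi <_) (double≡2* D) kHi<2D))

  even⇒¬BitSet : parity kHi ≡ 0ℙ → ¬ BitSet k b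
  even⇒¬BitSet even bitSet = 0≢1+n (trans (cong bit (sym even)) (trans (sym (n%2≡bit[parity] kHi)) bitSet))

  odd⇒BitSet : parity kHi ≡ 1ℙ → BitSet k b
  odd⇒BitSet odd = trans (n%2≡bit[parity] kHi) (cong bit odd)

mainTheorem2 : (k : ℕ) → 2 ≤ k → (j : ℕ) → 1 ≤ j → j ≤ 2 ^ r k ∸ 1 →
    (b : ℕ) → b < r k → IsPrimitiveRoot k j (2 ^ suc b) →
    (c k j ≡ zeroK k) ⇔ (¬ BitSet k b)
mainTheorem2 k _ j _ _ b b<r prim = by-parity (parity kHi) refl
  where
  open Block k j b b<r prim
  by-parity : ∀ p → parity kHi ≡ p → (c k j ≡ zeroK k) ⇔ (¬ BitSet k b)
  by-parity 0ℙ even = mk⇔ (λ _ → even⇒¬BitSet even) (λ _ → even⇒c≡0 even)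
  by-parity 1ℙ odd  = mk⇔ (λ c≡0 → contradiction c≡0 (odd⇒c≢0 odd)) (contradiction (odd⇒BitSet odd))
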